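{- Let $n\ge 0$ be an integer and define \[ g(n)=\begin{cases} 3^{n/3} & \text{if } n\equiv 0 \pmod 3,\\ 4\cdot 3^{(n-4)/3} & \text{if } n\equiv 1 \pmod 3,\\ 16\cdot 3^{(n-8)/3} & \text{if } n\equiv 2 \pmod 3.\end{cases} \] If $\mathcal{H}$ is a $3$-uniform hypergraph on $n$ vertices, then the number of maximal strongly independent sets of $\mathcal{H}$ is at most $g(n)$. Moreover, for every $n\ge 6$ there is a $3$-uniform hypergraph $\mathcal{H}$ on $n$ vertices whose number of maximal strongly independent sets equals $g(n)$.
   Context: A $3$-uniform hypergraph is a finite vertex set together with a family of $3$-element subsets (hyperedges). A set $S$ of vertices is strongly independent if every hyperedge shares at most one vertex with $S$. A strongly independent set is maximal if it is not a proper subset of another strongly independent set. -}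

module Defs where

open import Data.Nat using (ℕ; zero; suc; _+_; _*_; _^_; _≤_)
open import Data.Nat.DivMod using (_/_; _%_)
open import Data.Fin.Subset using (Subset; _∩_; ∣_∣; _⊂_)
open import Data.List using (List)
open import Data.List.Membership.Propositional using (_∈_)
open import Data.List.Relation.Unary.All using (All)
open import Data.Product using (_×_)
open import Relation.Binary.PropositionalEquality using (_≡_)
open import Relation.Nullary using (¬_)

record Hypergraph3 (n : ℕ) : Set where
  field
    edges   : List (Subset n)
    uniform : All (λ e → ∣ e ∣ ≡ 3) edges
open Hypergraph3 public

StronglyIndependent : ∀ {n} → Hypergraph3 n → Subset n → Set
StronglyIndependent H S = ∀ e → e ∈ edges H → ∣ e ∩ S ∣ ≤ 1

MaximalSI : ∀ {n} → Hypergraph3 n → Subset n → Set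
MaximalSI H S = StronglyIndependent H S × (∀ T → S ⊂ T → ¬ StronglyIndependent H T)

-- nineG n = 9 * g(n), where
--   g(n) = 3^(n/3)            if n ≡ 0 (mod 3)
--        = 4 * 3^((n-4)/3)     if n ≡ 1 (mod 3)
--        = 16 * 3^((n-8)/3)    if n ≡ 2 (mod 3).
-- (g(n) is not an integer for n = 1, 2, 5, but 9 g(n) always is.)
-- With q = n / 3:  n = 3q: 9*3^q;  n = 3q+1: 36*3^(q-1) = 4*3^(q+1);
--                  n = 3q+2: 144*3^(q-2) = 16*3^q.
nineG-aux : ℕ → ℕ → ℕ
nineG-aux q 0 = 9 * 3 ^ q
nineG-aux q 1 = 4 * 3 ^ (q + 1)
nineG-aux q _ = 16 * 3 ^ q

nineG : ℕ → ℕ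
nineG n = nineG-aux (n / 3) (n % 3)

-- A set is strongly independent in H exactly when it is independent in the shadow graph of H
-- (two vertices adjacent when some hyperedge contains both), so the maximal strongly
-- independent sets are the maximal independent sets of the shadow, and every shadow edge lies
-- in a triangle. Branching on the closed neighbourhood of a vertex of minimum degree k gives
-- the Moon–Moser recursion k·f(n − k) ≤ f(n), whose solution is g(n) except when n ≡ 2 (mod 3).
-- There triangles exclude k = 2, and for k = 3 either the closed neighbourhood is a triangle
-- component, whose removal keeps every edge in a triangle (3·g(n − 3) = g(n)), or some
-- neighbour has degree at least 4 and 2·f(n − 3) + f(n − 4) ≤ g(n).
-- Disjoint unions of triangles and copies of K₄⁽³⁾ attain g(n), and the upper bound forces
-- their listed maximal sets to be all of them.

module Submission where

open import Defs

open import Data.Bool.Base using (Bool; true; false; _∧_; _∨_; not)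
open import Data.Bool.ListAction using (any)
open import Data.Bool.Properties
  using (∧-comm; ∧-zeroʳ; ∧-conicalˡ; ∧-conicalʳ; ∨-assoc; ∨-identityʳ; ¬-not; T-≡)
  renaming (_≟_ to _≟ᵇ_)
open import Data.Empty using (⊥-elim)
open import Data.Fin using (Fin; zero; suc; _↑ˡ_; _↑ʳ_; splitAt)
open import Data.Fin.Properties
  using (_≟_; any?; all?; ↑ˡ-injective; ↑ʳ-injective; splitAt⁻¹-↑ˡ; splitAt⁻¹-↑ʳ)
open import Data.Fin.Subset using (Subset; ∣_∣; _∪_; ⁅_⁆; _⊂_; ∁; ⊤)
  renaming (_∈_ to _∈ₛ_; _∩_ to _∩ₛ_; ⊥ to ∅)
open import Data.Fin.Subset.Properties
  using (p⊆p∪q; q⊆p∪q; x∈p∪q⁻; x∈⁅x⁆; x∈⁅y⁆⇒x≡y; ∣⊥∣≡0)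
open import Data.List using (List; []; _∷_; length; map; filter; allFin; foldr; _++_; cartesianProductWith)
open import Data.List.Membership.Propositional using (_∈_; lose; find)
open import Data.List.Membership.Propositional.Properties using (∈-filter⁺; ∈-allFin)
open import Data.List.Properties using (filter-accept; length-map; map-cong; length-++)
open import Data.List.Relation.Unary.All as All using (All; []; _∷_)
open import Data.List.Relation.Unary.All.Properties
  using (all-filter; filter⁺; map⁺; ¬Any⇒All¬; ++⁺; cartesianProductWith⁺)
open import Data.List.Relation.Unary.AllPairs using ([]; _∷_)
open import Data.List.Relation.Unary.Any as Any using (Any; here; there)
import Data.List.Relation.Unary.Any.Properties as Anyₚ
open Anyₚ using (any⁺; any⁻)
open import Data.List.Relation.Unary.Unique.DecPropositional using (unique?)
open import Data.List.Relation.Unary.Unique.Propositional using (Unique)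
import Data.List.Relation.Unary.Unique.Propositional.Properties as Unique
open import Data.Nat using (ℕ; zero; suc; _+_; _*_; _^_; _∸_; _≤_; _<_; z≤n; s≤s; _≤?_)
  renaming (_≟_ to _≟ℕ_)
open import Data.Nat.DivMod using (_/_; _%_; m≡m%n+[m/n]*n; m%n<n; m/n≡1+[m∸n]/n; [m+n]%n≡m%n)
open import Data.Nat.Induction using (<-rec)
open import Data.Nat.ListAction using (sum)
open import Data.Nat.Properties hiding (_≟_)
open import Data.Nat.Tactic.RingSolver using (solve-∀)
open import Data.Product using (_×_; Σ; ∃; _,_; proj₁; proj₂)
open import Data.Sum using (_⊎_; inj₁; inj₂)
open import Data.Vec as Vec using (lookup; tabulate)
open import Data.Vec.Properties
  using ( lookup∘tabulate; tabulate∘lookup; tabulate-cong; lookup-zipWith; []=⇒lookup; lookup⇒[]=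
        ; lookup-++ˡ; lookup-++ʳ; lookup-replicate; ++-injective; ≡-dec)
open import Function using (_∘_; _$_)
open import Function.Bundles using (Equivalence)
open import Relation.Binary.PropositionalEquality
open import Relation.Nullary using (¬_; Dec; yes; no; does; contradiction)
open import Relation.Nullary.Decidable
  using (dec-true; dec-false; decidable-stable; _×-dec_; _→-dec_; ¬?; map′; True; toWitness)
open import Relation.Unary using (Decidable)

open import Algebra.Properties.CommutativeSemigroup *-commutativeSemigroup using (x∙yz≈y∙xz)

VertexSet : ℕ → Set
VertexSet n = Fin n → Bool

allVertices : ∀ {n} → VertexSet n
allVertices _ = true

_∩_ : ∀ {n} → VertexSet n → VertexSet n → VertexSet n
(A ∩ B) x = A x ∧ B x

_∖_ : ∀ {n} → VertexSet n → VertexSet n → VertexSet n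
(A ∖ B) x = A x ∧ not (B x)

_==_ : ∀ {n} → Fin n → Fin n → Bool
x == y = does (x ≟ y)

==-refl : ∀ {n} (x : Fin n) → (x == x) ≡ true
==-refl x = dec-true (x ≟ x) refl

==-≢ : ∀ {n} {x y : Fin n} → x ≢ y → (x == y) ≡ false
==-≢ {x = x} {y} = dec-false (x ≟ y)

==-sym : ∀ {n} (x y : Fin n) → (x == y) ≡ (y == x)
==-sym x y with x ≟ y
... | yes refl = sym (==-refl x)
... | no  x≢y  = sym (==-≢ (x≢y ∘ sym))

==⇒≡ : ∀ {n} {x y : Fin n} → (x == y) ≡ true → x ≡ y
==⇒≡ {x = x} {y} e with x ≟ y
... | yes x≡y = x≡y
==⇒≡ () | no _

==-injective : ∀ {m n} (f : Fin m → Fin n) → (∀ {x y} → f x ≡ f y → x ≡ y) →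
  ∀ x y → (f x == f y) ≡ (x == y)
==-injective f f-inj x y with x ≟ y
... | yes refl = ==-refl (f x)
... | no  x≢y  = ==-≢ (x≢y ∘ f-inj)

∧-≡-true : ∀ {a b} → a ≡ true → b ≡ true → a ∧ b ≡ true
∧-≡-true refl refl = refl

toℕᵇ : Bool → ℕ
toℕᵇ true = 1
toℕᵇ false = 0

count : ∀ {n} → VertexSet n → ℕ
count {zero} _ = 0
count {suc n} A = toℕᵇ (A zero) + count (A ∘ suc)

count-cong : ∀ {n} {A B : VertexSet n} → (∀ x → A x ≡ B x) → count A ≡ count B
count-cong {zero} _ = refl
count-cong {suc n} A≗B = cong₂ _+_ (cong toℕᵇ (A≗B zero)) (count-cong (A≗B ∘ suc))

count-split : ∀ {n} (A P : VertexSet n) → count A ≡ count (A ∩ P) + count (A ∖ P)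
count-split {zero} A P = refl
count-split {suc n} A P with A zero | P zero | count-split (A ∘ suc) (P ∘ suc)
... | true  | true  | ih = cong suc ih
... | true  | false | ih = trans (cong suc ih) (sym (+-suc _ _))
... | false | _     | ih = ih

count-mono : ∀ {n} {A B : VertexSet n} → (∀ x → A x ≡ true → B x ≡ true) → count A ≤ count B
count-mono {zero} _ = z≤n
count-mono {suc n} {A} {B} A⊆B with A zero in a | B zero in b
... | true  | true  = s≤s (count-mono (A⊆B ∘ suc))
... | false | true  = m≤n⇒m≤1+n (count-mono (A⊆B ∘ suc))
... | false | false = count-mono (A⊆B ∘ suc)
... | true  | false with () ← trans (sym b) (A⊆B zero a)

count-empty : ∀ {n} {A : VertexSet n} → (∀ x → A x ≡ false) → count A ≡ 0
count-empty {zero} _ = refl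
count-empty {suc n} {A} A≗∅ rewrite A≗∅ zero = count-empty (A≗∅ ∘ suc)

count-allVertices : ∀ n → count (allVertices {n}) ≡ n
count-allVertices zero = refl
count-allVertices (suc n) = cong suc (count-allVertices n)

count-singleton : ∀ {n} (x : Fin n) → count (_== x) ≡ 1
count-singleton {suc n} zero = cong suc (count-empty {n} λ _ → refl)
count-singleton (suc x) = count-singleton x

length≤count : ∀ {n} (A : VertexSet n) (xs : List (Fin n)) → Unique xs →
  All (λ x → A x ≡ true) xs → length xs ≤ count A
length≤count A [] _ _ = z≤n
length≤count A (x ∷ xs) (x∉xs ∷ u) (Ax ∷ As) = begin
  1 + length xs
    ≤⟨ +-mono-≤ (≤-trans (≤-reflexive (sym (count-singleton x))) (count-mono only-x))
                (length≤count _ xs u (rest xs x∉xs As)) ⟩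
  count (A ∩ (_== x)) + count (A ∖ (_== x))
    ≡⟨ count-split A (_== x) ⟨
  count A ∎
  where
  open ≤-Reasoning
  only-x : ∀ y → (y == x) ≡ true → (A ∩ (_== x)) y ≡ true
  only-x y y==x with refl ← ==⇒≡ {x = y} {x} y==x = ∧-≡-true Ax y==x
  rest : ∀ ys → All (x ≢_) ys → All (λ y → A y ≡ true) ys →
         All (λ y → (A ∖ (_== x)) y ≡ true) ys
  rest [] _ _ = []
  rest (y ∷ ys) (x≢y ∷ d) (Ay ∷ As) = ∧-≡-true Ay (cong not (==-≢ (x≢y ∘ sym))) ∷ rest ys d As

count≤length : ∀ {n} (A : VertexSet n) (xs : List (Fin n)) →
  (∀ y → A y ≡ true → y ∈ xs) → count A ≤ length xs
count≤length A [] A⊆[] = ≤-reflexive (count-empty A≗∅)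
  where
  A≗∅ : ∀ y → A y ≡ false
  A≗∅ y with A y in Ay
  ... | false = refl
  ... | true with () ← A⊆[] y Ay
count≤length A (x ∷ xs) A⊆x∷xs = begin
  count A
    ≡⟨ count-split A (_== x) ⟩
  count (A ∩ (_== x)) + count (A ∖ (_== x))
    ≤⟨ +-mono-≤ (≤-trans (count-mono (λ y → ∧-conicalʳ (A y) _)) (≤-reflexive (count-singleton x)))
                (count≤length _ xs A-x⊆xs) ⟩
  1 + length xs ∎
  where
  open ≤-Reasoning
  A-x⊆xs : ∀ y → (A ∖ (_== x)) y ≡ true → y ∈ xs
  A-x⊆xs y Ay-x with A⊆x∷xs y (∧-conicalˡ _ _ Ay-x)
  ... | there y∈xs = y∈xs
  ... | here refl rewrite ==-refl y with () ← ∧-conicalʳ (A y) _ Ay-x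

elements : ∀ {n} → VertexSet n → List (Fin n)
elements A = filter (λ x → A x ≟ᵇ true) (allFin _)

∈-elements : ∀ {n} {A : VertexSet n} {x} → A x ≡ true → x ∈ elements A
∈-elements {x = x} Ax = ∈-filter⁺ _ (∈-allFin x) Ax

length-elements : ∀ {n} (A : VertexSet n) → length (elements A) ≤ count A
length-elements A =
  length≤count A (elements A) (Unique.filter⁺ _ (Unique.allFin⁺ _)) (all-filter _ (allFin _))

argmin : ∀ {n} (A : VertexSet n) (f : Fin n → ℕ) →
  (∀ x → A x ≡ false) ⊎ ∃ λ v → A v ≡ true × ∀ u → A u ≡ true → f v ≤ f u
argmin {zero} A f = inj₁ λ ()
argmin {suc n} A f with argmin (A ∘ suc) (f ∘ suc) | A zero in A0
... | inj₁ empty | false = inj₁ λ { zero → A0 ; (suc x) → empty x }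
... | inj₁ empty | true  = inj₂ (zero , A0 , λ
  { zero _ → ≤-refl
  ; (suc x) Ax → contradiction (trans (sym Ax) (empty x)) λ () })
... | inj₂ (v , Av , min) | false = inj₂ (suc v , Av , λ
  { zero A0′ → contradiction (trans (sym A0′) A0) λ ()
  ; (suc x) Ax → min x Ax })
... | inj₂ (v , Av , min) | true with f zero ≤? f (suc v)
...   | yes f0≤fv = inj₂ (zero , A0 , λ { zero _ → ≤-refl ; (suc x) Ax → ≤-trans f0≤fv (min x Ax) })
...   | no  f0≰fv = inj₂ (suc v , Av , λ { zero _ → <⇒≤ (≰⇒> f0≰fv) ; (suc x) Ax → min x Ax })

count≤length⇒∈ : ∀ {n} (A : VertexSet n) (xs : List (Fin n)) → Unique xs →
  All (λ x → A x ≡ true) xs → count A ≤ length xs → ∀ x → A x ≡ true → x ∈ xs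
count≤length⇒∈ A xs u As |A|≤ x Ax with Any.any? (x ≟_) xs
... | yes x∈xs = x∈xs
... | no  x∉xs = contradiction
  (≤-trans (length≤count A (x ∷ xs) (¬Any⇒All¬ xs x∉xs ∷ u) (Ax ∷ As)) |A|≤) (<-irrefl refl)

count>length⇒∃∉ : ∀ {n} (A : VertexSet n) (xs : List (Fin n)) → length xs < count A →
  ∃ λ y → A y ≡ true × ¬ y ∈ xs
count>length⇒∃∉ A xs len<count with any? (λ y → (A y ≟ᵇ true) ×-dec ¬? (Any.any? (y ≟_) xs))
... | yes witness = witness
... | no ∄y = contradiction (count≤length A xs in-xs) (<⇒≱ len<count)
  where
  in-xs : ∀ y → A y ≡ true → y ∈ xs
  in-xs y Ay = decidable-stable (Any.any? (y ≟_) xs) λ y∉xs → ∄y (y , Ay , y∉xs)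

count≤1 : ∀ {n} (A : VertexSet n) → (∀ x y → A x ≡ true → A y ≡ true → x ≡ y) → count A ≤ 1
count≤1 A A-subsingleton with any? (λ y → A y ≟ᵇ true)
... | yes (z , Az) = count≤length A (z ∷ []) λ y Ay → here (A-subsingleton y z Ay Az)
... | no ∄z = ≤-trans (≤-reflexive (count-empty λ y → ¬-not λ Ay → ∄z (y , Ay))) z≤n

∖-∉ : ∀ {n} (A B : VertexSet n) x → (A ∖ B) x ≡ true → B x ≡ false
∖-∉ A B x A∖Bx with B x | ∧-conicalʳ (A x) _ A∖Bx
... | false | _ = refl
... | true  | ()

Subset-ext : ∀ {n} {S T : Subset n} → (∀ x → lookup S x ≡ lookup T x) → S ≡ T
Subset-ext {S = S} {T} S≗T = trans (sym (tabulate∘lookup S)) (trans (tabulate-cong S≗T) (tabulate∘lookup T))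

∣∣≡count : ∀ {n} (p : Subset n) → ∣ p ∣ ≡ count (lookup p)
∣∣≡count Vec.[] = refl
∣∣≡count (true Vec.∷ p) = cong suc (∣∣≡count p)
∣∣≡count (false Vec.∷ p) = ∣∣≡count p

∣∩ₛ∣≡count : ∀ {n} (p q : Subset n) → ∣ p ∩ₛ q ∣ ≡ count (lookup p ∩ lookup q)
∣∩ₛ∣≡count p q = trans (∣∣≡count (p ∩ₛ q)) (count-cong λ x → lookup-zipWith _∧_ x p q)

∣++∅∣ : ∀ {m n} (p : Subset m) → ∣ p Vec.++ ∅ {n} ∣ ≡ ∣ p ∣
∣++∅∣ {n = n} Vec.[] = ∣⊥∣≡0 n
∣++∅∣ (true Vec.∷ p) = cong suc (∣++∅∣ p)
∣++∅∣ (false Vec.∷ p) = ∣++∅∣ p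

∣∅++∣ : ∀ m {n} (p : Subset n) → ∣ ∅ {m} Vec.++ p ∣ ≡ ∣ p ∣
∣∅++∣ zero p = refl
∣∅++∣ (suc m) p = ∣∅++∣ m p

data SplitView (m n : ℕ) : Fin (m + n) → Set where
  left  : ∀ x → SplitView m n (x ↑ˡ n)
  right : ∀ y → SplitView m n (m ↑ʳ y)

splitView : ∀ m n z → SplitView m n z
splitView m n z with splitAt m z in eq
... | inj₁ x = subst (SplitView m n) (splitAt⁻¹-↑ˡ eq) (left x)
... | inj₂ y = subst (SplitView m n) (splitAt⁻¹-↑ʳ eq) (right y)

Unique-map⁺ : {A B : Set} {P : A → Set} (f : A → B) →
  (∀ {x y} → P x → P y → f x ≡ f y → x ≡ y) →
  ∀ {xs} → All P xs → Unique xs → Unique (map f xs)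
Unique-map⁺ f inj [] [] = []
Unique-map⁺ {P = P} f inj {x ∷ _} (Px ∷ Ps) (x∉ ∷ u) = fresh Ps x∉ ∷ Unique-map⁺ f inj Ps u
  where
  fresh : ∀ {ys} → All P ys → All (x ≢_) ys → All (f x ≢_) (map f ys)
  fresh [] [] = []
  fresh (Py ∷ Ps) (x≢y ∷ x∉) = (x≢y ∘ inj Px Py) ∷ fresh Ps x∉

sum-map-mono : {K : Set} (f g : K → ℕ) → ∀ ks → All (λ k → f k ≤ g k) ks →
  sum (map f ks) ≤ sum (map g ks)
sum-map-mono f g [] [] = z≤n
sum-map-mono f g (k ∷ ks) (fk≤gk ∷ f≤g) = +-mono-≤ fk≤gk (sum-map-mono f g ks f≤g)

sum-map-*ʳ : {K : Set} (f : K → ℕ) (c : ℕ) → ∀ ks →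
  sum (map f ks) * c ≡ sum (map (λ k → f k * c) ks)
sum-map-*ʳ f c [] = refl
sum-map-*ʳ f c (k ∷ ks) = trans (*-distribʳ-+ c (f k) _) (cong (f k * c +_) (sum-map-*ʳ f c ks))

any-++ : {A : Set} (p : A → Bool) (xs ys : List A) → any p (xs ++ ys) ≡ any p xs ∨ any p ys
any-++ p [] ys = refl
any-++ p (x ∷ xs) ys = trans (cong (p x ∨_) (any-++ p xs ys)) (sym (∨-assoc (p x) _ _))

any-map : {A B : Set} {p : B → Bool} (f : A → B) → ∀ xs → any p (map f xs) ≡ any (p ∘ f) xs
any-map f [] = refl
any-map {p = p} f (x ∷ xs) = cong (p (f x) ∨_) (any-map f xs)

any-cong : {A : Set} {p q : A → Bool} → (∀ x → p x ≡ q x) → ∀ xs → any p xs ≡ any q xs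
any-cong p≗q [] = refl
any-cong p≗q (x ∷ xs) = cong₂ _∨_ (p≗q x) (any-cong p≗q xs)

any-false-cong : {A : Set} {p : A → Bool} → (∀ x → p x ≡ false) → ∀ xs → any p xs ≡ false
any-false-cong p≗false [] = refl
any-false-cong p≗false (x ∷ xs) = cong₂ _∨_ (p≗false x) (any-false-cong p≗false xs)

length-cartesianProductWith : {A B C : Set} (f : A → B → C) (xs : List A) (ys : List B) →
  length (cartesianProductWith f xs ys) ≡ length xs * length ys
length-cartesianProductWith f [] ys = refl
length-cartesianProductWith f (x ∷ xs) ys = trans (length-++ (map (f x) ys))
  (cong₂ _+_ (length-map (f x) ys) (length-cartesianProductWith f xs ys))

module _ {A B : Set} {P : B → A → Set} (P? : ∀ b → Decidable (P b)) where

  hits : List B → List A → ℕ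
  hits bs xs = sum (map (λ b → length (filter (P? b) xs)) bs)

  length-filter-∷ : ∀ b x xs → length (filter (P? b) xs) ≤ length (filter (P? b) (x ∷ xs))
  length-filter-∷ b x xs with does (P? b x)
  ... | true  = n≤1+n _
  ... | false = ≤-refl

  hits-∷ : ∀ {bs} x xs → Any (λ b → P b x) bs → suc (hits bs xs) ≤ hits bs (x ∷ xs)
  hits-∷ {b ∷ bs} x xs (here Pbx) rewrite filter-accept (P? b) {xs = xs} Pbx =
    s≤s (+-monoʳ-≤ _ (sum-map-mono _ _ bs (All.tabulate λ {b′} _ → length-filter-∷ b′ x xs)))
  hits-∷ {b ∷ bs} x xs (there hit) =
    ≤-trans (≤-reflexive (sym (+-suc _ _))) (+-mono-≤ (length-filter-∷ b x xs) (hits-∷ x xs hit))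

  length≤hits : ∀ bs xs → All (λ x → Any (λ b → P b x) bs) xs → length xs ≤ hits bs xs
  length≤hits bs [] [] = z≤n
  length≤hits bs (x ∷ xs) (hit ∷ hit-all) = ≤-trans (s≤s (length≤hits bs xs hit-all)) (hits-∷ x xs hit)

-- The Moon–Moser bound

-- Nine times the Moon–Moser bound 3^q, 4·3^(q-1), 2·3^q for m = 3q, 3q+1, 3q+2;
-- the factor 9 makes the value at m = 1 an integer (it exceeds the true bound there).
moonMoser : ℕ → ℕ
moonMoser 0 = 9
moonMoser 1 = 12
moonMoser 2 = 18
moonMoser (suc (suc (suc m))) = 3 * moonMoser m

9≤moonMoser : ∀ m → 9 ≤ moonMoser m
9≤moonMoser 0 = ≤-refl
9≤moonMoser 1 = m≤m+n 9 3
9≤moonMoser 2 = m≤m+n 9 9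
9≤moonMoser (suc (suc (suc m))) = ≤-trans (9≤moonMoser m) (m≤m+n _ _)

moonMoser[+3*] : ∀ r q → moonMoser (r + 3 * q) ≡ moonMoser r * 3 ^ q
moonMoser[+3*] r zero = trans (cong moonMoser (+-identityʳ r)) (sym (*-identityʳ _))
moonMoser[+3*] r (suc q) = begin
  moonMoser (r + 3 * suc q)     ≡⟨ cong moonMoser (r+3[1+q]≡3+[r+3q] r q) ⟩
  3 * moonMoser (r + 3 * q)     ≡⟨ cong (3 *_) (moonMoser[+3*] r q) ⟩
  3 * (moonMoser r * 3 ^ q)     ≡⟨ x∙yz≈y∙xz 3 (moonMoser r) (3 ^ q) ⟩
  moonMoser r * 3 ^ suc q       ∎
  where
  open ≡-Reasoning
  r+3[1+q]≡3+[r+3q] : ∀ r q → r + 3 * suc q ≡ 3 + (r + 3 * q)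
  r+3[1+q]≡3+[r+3q] = solve-∀

2*moonMoser≤moonMoser[2+] : ∀ r → 2 * moonMoser r ≤ moonMoser (2 + r)
2*moonMoser≤moonMoser[2+] 0 = ≤-refl
2*moonMoser≤moonMoser[2+] 1 = m≤m+n 24 3
2*moonMoser≤moonMoser[2+] 2 = ≤-refl
2*moonMoser≤moonMoser[2+] (suc (suc (suc r))) = subst (_≤ moonMoser (5 + r)) (x∙yz≈y∙xz 3 2 (moonMoser r))
  (*-monoʳ-≤ 3 (2*moonMoser≤moonMoser[2+] r))

4*moonMoser≤moonMoser[4+] : ∀ r → 4 * moonMoser r ≤ moonMoser (4 + r)
4*moonMoser≤moonMoser[4+] 0 = ≤-refl
4*moonMoser≤moonMoser[4+] 1 = m≤m+n 48 6
4*moonMoser≤moonMoser[4+] 2 = m≤m+n 72 9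
4*moonMoser≤moonMoser[4+] (suc (suc (suc r))) = subst (_≤ moonMoser (7 + r)) (x∙yz≈y∙xz 3 4 (moonMoser r))
  (*-monoʳ-≤ 3 (4*moonMoser≤moonMoser[4+] r))

*moonMoser≤moonMoser[+] : ∀ k r → 1 ≤ k → k * moonMoser r ≤ moonMoser (k + r)
*moonMoser≤moonMoser[+] 1 r _ = ≤-trans (≤-reflexive (+-identityʳ _)) (moonMoser-≤-suc r)
  where
  moonMoser-≤-suc : ∀ r → moonMoser r ≤ moonMoser (suc r)
  moonMoser-≤-suc 0 = m≤m+n 9 3
  moonMoser-≤-suc 1 = m≤m+n 12 6
  moonMoser-≤-suc 2 = m≤m+n 18 9
  moonMoser-≤-suc (suc (suc (suc r))) = *-monoʳ-≤ 3 (moonMoser-≤-suc r)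
*moonMoser≤moonMoser[+] 2 r _ = 2*moonMoser≤moonMoser[2+] r
*moonMoser≤moonMoser[+] 3 r _ = ≤-refl
*moonMoser≤moonMoser[+] 4 r _ = 4*moonMoser≤moonMoser[4+] r
*moonMoser≤moonMoser[+] (suc (suc (suc (suc (suc j))))) r _ = begin
  (5 + j) * moonMoser r        ≤⟨ *-monoˡ-≤ (moonMoser r) (m≤n+m (5 + j) (1 + 2 * j)) ⟩
  (1 + 2 * j + (5 + j)) * moonMoser r ≡⟨ cong (_* moonMoser r) (1+2j+[5+j]≡3[2+j] j) ⟩
  3 * (2 + j) * moonMoser r    ≡⟨ *-assoc 3 (2 + j) (moonMoser r) ⟩
  3 * ((2 + j) * moonMoser r)  ≤⟨ *-monoʳ-≤ 3 (*moonMoser≤moonMoser[+] (suc (suc j)) r (s≤s z≤n)) ⟩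
  moonMoser (5 + j + r)        ∎
  where
  open ≤-Reasoning
  1+2j+[5+j]≡3[2+j] : ∀ j → 1 + 2 * j + (5 + j) ≡ 3 * (2 + j)
  1+2j+[5+j]≡3[2+j] = solve-∀


5*moonMoser≤4*moonMoser[1+] : ∀ r → 5 * moonMoser r ≤ 4 * moonMoser (1 + r)
5*moonMoser≤4*moonMoser[1+] 0 = m≤m+n 45 3
5*moonMoser≤4*moonMoser[1+] 1 = m≤m+n 60 12
5*moonMoser≤4*moonMoser[1+] 2 = m≤m+n 90 18
5*moonMoser≤4*moonMoser[1+] (suc (suc (suc r))) = begin
  5 * (3 * moonMoser r)         ≡⟨ x∙yz≈y∙xz 5 3 (moonMoser r) ⟩
  3 * (5 * moonMoser r)         ≤⟨ *-monoʳ-≤ 3 (5*moonMoser≤4*moonMoser[1+] r) ⟩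
  3 * (4 * moonMoser (1 + r))   ≡⟨ x∙yz≈y∙xz 3 4 (moonMoser (1 + r)) ⟩
  4 * moonMoser (4 + r)         ∎
  where open ≤-Reasoning

[4+]*moonMoser≤4*moonMoser[+] : ∀ j r → (4 + j) * moonMoser r ≤ 4 * moonMoser (j + r)
[4+]*moonMoser≤4*moonMoser[+] 0 r = ≤-refl
[4+]*moonMoser≤4*moonMoser[+] 1 r = 5*moonMoser≤4*moonMoser[1+] r
[4+]*moonMoser≤4*moonMoser[+] 2 r = begin
  6 * moonMoser r          ≡⟨ *-assoc 3 2 (moonMoser r) ⟩
  3 * (2 * moonMoser r)    ≤⟨ *-mono-≤ (n≤1+n 3) (2*moonMoser≤moonMoser[2+] r) ⟩
  4 * moonMoser (2 + r)    ∎
  where open ≤-Reasoning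
[4+]*moonMoser≤4*moonMoser[+] (suc (suc (suc i))) r = begin
  (7 + i) * moonMoser r          ≤⟨ *-monoˡ-≤ (moonMoser r) (m≤n+m (7 + i) (5 + 2 * i)) ⟩
  (5 + 2 * i + (7 + i)) * moonMoser r ≡⟨ cong (_* moonMoser r) (5+2i+[7+i]≡3[4+i] i) ⟩
  3 * (4 + i) * moonMoser r      ≡⟨ *-assoc 3 (4 + i) (moonMoser r) ⟩
  3 * ((4 + i) * moonMoser r)    ≤⟨ *-monoʳ-≤ 3 ([4+]*moonMoser≤4*moonMoser[+] i r) ⟩
  3 * (4 * moonMoser (i + r))    ≡⟨ x∙yz≈y∙xz 3 4 (moonMoser (i + r)) ⟩
  4 * moonMoser (3 + i + r)      ∎
  where
  open ≤-Reasoning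
  5+2i+[7+i]≡3[4+i] : ∀ i → 5 + 2 * i + (7 + i) ≡ 3 * (4 + i)
  5+2i+[7+i]≡3[4+i] = solve-∀

moonMoser[1+3*]≤16*3^ : ∀ q → moonMoser (1 + 3 * q) ≤ 16 * 3 ^ q
moonMoser[1+3*]≤16*3^ q =
  subst (_≤ 16 * 3 ^ q) (sym (moonMoser[+3*] 1 q)) (*-monoˡ-≤ (3 ^ q) (m≤m+n 12 4))

[4+]*moonMoser≤16*3^ : ∀ j r q → 4 + j + r ≡ 2 + 3 * q → (4 + j) * moonMoser r ≤ 16 * 3 ^ q
[4+]*moonMoser≤16*3^ j r (suc p) j+r+4≡2+3q = begin
  (4 + j) * moonMoser r          ≤⟨ [4+]*moonMoser≤4*moonMoser[+] j r ⟩
  4 * moonMoser (j + r)          ≡⟨ cong (λ t → 4 * moonMoser t) j+r≡1+3p ⟩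
  4 * moonMoser (1 + 3 * p)      ≡⟨ cong (4 *_) (moonMoser[+3*] 1 p) ⟩
  4 * (12 * 3 ^ p)               ≡⟨ 4*[12x]≡16*[3x] (3 ^ p) ⟩
  16 * 3 ^ suc p                 ∎
  where
  open ≤-Reasoning
  j+r≡1+3p : j + r ≡ 1 + 3 * p
  j+r≡1+3p = +-cancelˡ-≡ 4 _ _ (trans j+r+4≡2+3q (2+3[1+p]≡4+[1+3p] p))
    where
    2+3[1+p]≡4+[1+3p] : ∀ p → 2 + 3 * suc p ≡ 4 + (1 + 3 * p)
    2+3[1+p]≡4+[1+3p] = solve-∀
  4*[12x]≡16*[3x] : ∀ x → 4 * (12 * x) ≡ 16 * (3 * x)
  4*[12x]≡16*[3x] = solve-∀

record Graph (n : ℕ) : Set where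
  field
    adj     : Fin n → Fin n → Bool
    adj-sym : ∀ x y → adj x y ≡ adj y x
    adj-irr : ∀ x → adj x x ≡ false
open Graph public

adj⇒≢ : ∀ {n} (G : Graph n) {x y} → adj G x y ≡ true → x ≢ y
adj⇒≢ G {x} adj-xy refl with () ← trans (sym adj-xy) (adj-irr G x)

module _ {n : ℕ} (G : Graph n) where

  N[_] : Fin n → VertexSet n
  N[ u ] x = adj G u x ∨ (x == u)

  degree : VertexSet n → Fin n → ℕ
  degree W u = count (W ∩ N[ u ])

  Independent : Subset n → Set
  Independent S = ∀ x y → lookup S x ≡ true → lookup S y ≡ true → adj G x y ≡ false

  record IsMIS (W : VertexSet n) (S : Subset n) : Set where
    constructor mis
    field
      ⊆W          : ∀ x → lookup S x ≡ true → W x ≡ true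
      independent : Independent S
      dominating  : ∀ x → W x ≡ true → lookup S x ≡ false →
                    ∃ λ y → lookup S y ≡ true × adj G x y ≡ true

  MISBound : VertexSet n → ℕ → Set
  MISBound W b = ∀ L → Unique L → All (IsMIS W) L → length L * 9 ≤ b

  MISBound-weaken : ∀ {W b c} → b ≤ c → MISBound W b → MISBound W c
  MISBound-weaken b≤c bound L u ms = ≤-trans (bound L u ms) b≤c

  ∈N[]-self : ∀ W v → W v ≡ true → (W ∩ N[ v ]) v ≡ true
  ∈N[]-self W v Wv rewrite Wv | adj-irr G v | ==-refl v = refl

  ∈N[]-adj : ∀ W v y → W y ≡ true → adj G v y ≡ true → (W ∩ N[ v ]) y ≡ true
  ∈N[]-adj W v y Wy adj-vy rewrite Wy | adj-vy = refl

  1≤degree : ∀ W v → W v ≡ true → 1 ≤ degree W v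
  1≤degree W v Wv = length≤count (W ∩ N[ v ]) (v ∷ []) ([] ∷ []) (∈N[]-self W v Wv ∷ [])

  degree≤count : ∀ W v → degree W v ≤ count W
  degree≤count W v = count-mono {A = W ∩ N[ v ]} λ x → ∧-conicalˡ _ _

  count-∖N[] : ∀ W u → count W ≡ degree W u + count (W ∖ N[ u ])
  count-∖N[] W u = count-split W N[ u ]

  ∖N[]⇒¬adj : ∀ {W u x} → (W ∖ N[ u ]) x ≡ true → adj G u x ≡ false
  ∖N[]⇒¬adj {W} {u} {x} Rx with adj G u x | ∧-conicalʳ (W x) _ Rx
  ... | false | _ = refl
  ... | true | ()

  count-∖N[]≤ : ∀ W u {m k} → count W ≤ m → k ≤ degree W u → count (W ∖ N[ u ]) ≤ m ∸ k
  count-∖N[]≤ W u {m} {k} |W|≤m k≤deg = m+n≤o⇒m≤o∸n _ (begin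
    count (W ∖ N[ u ]) + k            ≤⟨ +-monoʳ-≤ _ k≤deg ⟩
    count (W ∖ N[ u ]) + degree W u   ≡⟨ +-comm _ (degree W u) ⟩
    degree W u + count (W ∖ N[ u ])   ≡⟨ count-∖N[] W u ⟨
    count W                           ≤⟨ |W|≤m ⟩
    m                                 ∎)
    where open ≤-Reasoning

  MISBound-empty : ∀ {W} → (∀ x → W x ≡ false) → MISBound W 9
  MISBound-empty W≗∅ [] _ _ = z≤n
  MISBound-empty W≗∅ (S ∷ []) _ _ = ≤-refl
  MISBound-empty {W} W≗∅ (S ∷ T ∷ L) ((S≢T ∷ _) ∷ _) (mS ∷ mT ∷ _) =
    ⊥-elim (S≢T (Subset-ext λ x → trans (empty mS x) (sym (empty mT x))))
    where
    empty : ∀ {S} → IsMIS W S → ∀ x → lookup S x ≡ false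
    empty {S} m x with lookup S x in Sx
    ... | false = refl
    ... | true with () ← trans (sym (IsMIS.⊆W m x Sx)) (W≗∅ x)

  module _ (W : VertexSet n) (u : Fin n) where

    restrict : Subset n → Subset n
    restrict S = tabulate (lookup S ∩ (W ∖ N[ u ]))

    lookup-restrict : ∀ S x → lookup (restrict S) x ≡ lookup S x ∧ (W ∖ N[ u ]) x
    lookup-restrict S = lookup∘tabulate _

    MIS∋u⇒∈∖N[] : ∀ {S} → IsMIS W S → lookup S u ≡ true →
      ∀ x → lookup S x ≡ true → x ≢ u → (W ∖ N[ u ]) x ≡ true
    MIS∋u⇒∈∖N[] (mis ⊆W indep _) Su x Sx x≢u
      rewrite ⊆W x Sx | indep u x Su Sx | ==-≢ x≢u = refl

    restrict-MIS : ∀ {S} → IsMIS W S → lookup S u ≡ true → IsMIS (W ∖ N[ u ]) (restrict S)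
    restrict-MIS {S} m@(mis ⊆W indep dom) Su = mis ⊆R indep′ dom′
      where
      ∈S : ∀ x → lookup (restrict S) x ≡ true → lookup S x ≡ true
      ∈S x rx = ∧-conicalˡ _ _ (trans (sym (lookup-restrict S x)) rx)
      ⊆R : ∀ x → lookup (restrict S) x ≡ true → (W ∖ N[ u ]) x ≡ true
      ⊆R x rx = ∧-conicalʳ (lookup S x) _ (trans (sym (lookup-restrict S x)) rx)
      indep′ : ∀ x y → lookup (restrict S) x ≡ true → lookup (restrict S) y ≡ true → adj G x y ≡ false
      indep′ x y rx ry = indep x y (∈S x rx) (∈S y ry)
      dom′ : ∀ x → (W ∖ N[ u ]) x ≡ true → lookup (restrict S) x ≡ false →
             ∃ λ y → lookup (restrict S) y ≡ true × adj G x y ≡ true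
      dom′ x Rx ¬rx with lookup S x in Sx
      ... | true with () ← trans (sym ¬rx) (trans (lookup-restrict S x) (∧-≡-true Sx Rx))
      ... | false with dom x (∧-conicalˡ _ _ Rx) Sx
      ... | y , Sy , adj-xy = y , ry , adj-xy
        where
        y≢u : y ≢ u
        y≢u refl with () ← trans (sym (∖N[]⇒¬adj {W} Rx)) (trans (adj-sym G u x) adj-xy)
        ry : lookup (restrict S) y ≡ true
        ry = trans (lookup-restrict S y) (∧-≡-true Sy (MIS∋u⇒∈∖N[] m Su y Sy y≢u))

    restrict-injective : ∀ {S T} → IsMIS W S → lookup S u ≡ true → IsMIS W T → lookup T u ≡ true →
      restrict S ≡ restrict T → S ≡ T
    restrict-injective {S} {T} mS Su mT Tu rS≡rT = Subset-ext S≗T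
      where
      unrestrict : ∀ {S} → IsMIS W S → lookup S u ≡ true →
                   ∀ x → x ≢ u → lookup (restrict S) x ≡ lookup S x
      unrestrict {S} m Su x x≢u with lookup S x in Sx
      ... | true  = trans (lookup-restrict S x) (trans (cong (_∧ _) Sx) (MIS∋u⇒∈∖N[] m Su x Sx x≢u))
      ... | false = trans (lookup-restrict S x) (cong (_∧ _) Sx)
      S≗T : ∀ x → lookup S x ≡ lookup T x
      S≗T x with x ≟ u
      ... | yes refl = trans Su (sym Tu)
      ... | no x≢u = begin
        lookup S x           ≡⟨ unrestrict mS Su x x≢u ⟨
        lookup (restrict S) x ≡⟨ cong (λ V → lookup V x) rS≡rT ⟩
        lookup (restrict T) x ≡⟨ unrestrict mT Tu x x≢u ⟩
        lookup T x           ∎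
        where open ≡-Reasoning

  MISBound-∋ : ∀ W u {b} → MISBound (W ∖ N[ u ]) b → ∀ L → Unique L → All (IsMIS W) L →
    length (filter (λ S → lookup S u ≟ᵇ true) L) * 9 ≤ b
  MISBound-∋ W u bound L uL mL = subst (λ k → k * 9 ≤ _) (length-map (restrict W u) L∋u)
    (bound (map (restrict W u) L∋u)
      (Unique-map⁺ (restrict W u) (λ (mS , Su) (mT , Tu) → restrict-injective W u mS Su mT Tu)
        mL∋u (Unique.filter⁺ _ uL))
      (map⁺ (All.map (λ (mS , Su) → restrict-MIS W u mS Su) mL∋u)))
    where
    L∋u : List (Subset n)
    L∋u = filter (λ S → lookup S u ≟ᵇ true) L
    mL∋u : All (λ S → IsMIS W S × lookup S u ≡ true) L∋u
    mL∋u = All.zip (filter⁺ _ mL , all-filter _ L)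

  MISBound-cover : ∀ W (ks : List (Fin n × ℕ)) →
    (∀ S → IsMIS W S → Any (λ k → lookup S (proj₁ k) ≡ true) ks) →
    All (λ k → MISBound (W ∖ N[ proj₁ k ]) (proj₂ k)) ks →
    MISBound W (sum (map proj₂ ks))
  MISBound-cover W ks covers bounds L uL mL = begin
    length L * 9                             ≤⟨ *-monoˡ-≤ 9 (length≤hits ∋? ks L (All.map (covers _) mL)) ⟩
    hits ∋? ks L * 9                         ≡⟨ sum-map-*ʳ (λ k → length (filter (∋? k) L)) 9 ks ⟩
    sum (map (λ k → length (filter (∋? k) L) * 9) ks)
      ≤⟨ sum-map-mono _ proj₂ ks (All.map (λ bound → MISBound-∋ W _ bound L uL mL) bounds) ⟩
    sum (map proj₂ ks)                       ∎
    where
    open ≤-Reasoning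
    ∋? : ∀ (k : Fin n × ℕ) → Decidable (λ S → lookup S (proj₁ k) ≡ true)
    ∋? k S = lookup S (proj₁ k) ≟ᵇ true

  MISBound-branch : ∀ W v b → W v ≡ true →
    (∀ u → (W ∩ N[ v ]) u ≡ true → MISBound (W ∖ N[ u ]) b) → MISBound W (degree W v * b)
  MISBound-branch W v b Wv bounds = MISBound-weaken total≤
    (MISBound-cover W ks covers (map⁺ (All.map (λ {u} → bounds u) (all-filter _ (allFin _)))))
    where
    ks : List (Fin n × ℕ)
    ks = map (λ u → u , b) (elements (W ∩ N[ v ]))
    covers : ∀ S → IsMIS W S → Any (λ k → lookup S (proj₁ k) ≡ true) ks
    covers S (mis ⊆W _ dom) = Anyₚ.map⁺ (hit (lookup S v) refl)
      where
      hit : ∀ s → lookup S v ≡ s → Any (λ u → lookup S u ≡ true) (elements (W ∩ N[ v ]))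
      hit true Sv = lose (∈-elements (∈N[]-self W v Wv)) Sv
      hit false Sv with dom v Wv Sv
      ... | y , Sy , adj-vy = lose (∈-elements (∈N[]-adj W v y (⊆W y Sy) adj-vy)) Sy
    sum-const : ∀ xs → sum (map proj₂ (map (λ u → u , b) xs)) ≡ length xs * b
    sum-const [] = refl
    sum-const (x ∷ xs) = cong (b +_) (sum-const xs)
    total≤ : sum (map proj₂ ks) ≤ degree W v * b
    total≤ = ≤-trans (≤-reflexive (sum-const (elements (W ∩ N[ v ]))))
                     (*-monoˡ-≤ b (length-elements (W ∩ N[ v ])))

  MISBound-moonMoser : ∀ m W → count W ≤ m → MISBound W (moonMoser m)
  MISBound-moonMoser = <-rec _ step
    where
    step : ∀ m → (∀ {m′} → m′ < m → ∀ W → count W ≤ m′ → MISBound W (moonMoser m′)) →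
           ∀ W → count W ≤ m → MISBound W (moonMoser m)
    step m rec W |W|≤m with argmin W (degree W)
    ... | inj₁ empty = MISBound-weaken (9≤moonMoser m) (MISBound-empty empty)
    ... | inj₂ (v , Wv , minimal) = MISBound-weaken k*M≤M
          (MISBound-branch W v (moonMoser (m ∸ k)) Wv λ u u∈N[v] →
            rec (∸-monoʳ-< (1≤degree W v Wv) k≤m) (W ∖ N[ u ])
              (count-∖N[]≤ W u |W|≤m (minimal u (∧-conicalˡ _ _ u∈N[v]))))
      where
      k : ℕ
      k = degree W v
      k≤m : k ≤ m
      k≤m = ≤-trans (degree≤count W v) |W|≤m
      k*M≤M : k * moonMoser (m ∸ k) ≤ moonMoser m
      k*M≤M = subst (λ t → k * moonMoser (m ∸ k) ≤ moonMoser t) (m+[n∸m]≡n k≤m)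
        (*moonMoser≤moonMoser[+] k (m ∸ k) (1≤degree W v Wv))

  MISBound-∖N[] : ∀ W u {m k} → count W ≤ m → k ≤ degree W u →
    MISBound (W ∖ N[ u ]) (moonMoser (m ∸ k))
  MISBound-∖N[] W u {m} {k} |W|≤m k≤deg = MISBound-moonMoser (m ∸ k) _ (count-∖N[]≤ W u |W|≤m k≤deg)

  MISBound-minDegree : ∀ W v m → W v ≡ true → (∀ u → W u ≡ true → degree W v ≤ degree W u) →
    count W ≤ m → MISBound W (degree W v * moonMoser (m ∸ degree W v))
  MISBound-minDegree W v m Wv minimal |W|≤m = MISBound-branch W v _ Wv λ u u∈N[v] →
    MISBound-∖N[] W u |W|≤m (minimal u (∧-conicalˡ _ _ u∈N[v]))

  neighbour : ∀ W v → 2 ≤ degree W v → ∃ λ a → W a ≡ true × adj G v a ≡ true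
  neighbour W v 2≤deg with count>length⇒∃∉ (W ∩ N[ v ]) (v ∷ []) 2≤deg
  ... | a , a∈N[v] , a∉[v] with a ≟ v
  ...   | yes a≡v = contradiction (here a≡v) a∉[v]
  ...   | no  _   =
    a , ∧-conicalˡ _ _ a∈N[v] , trans (sym (∨-identityʳ (adj G v a))) (∧-conicalʳ (W a) _ a∈N[v])

  -- Triangle-closed graphs

  TriangleClosed : VertexSet n → Set
  TriangleClosed W = ∀ x y → W x ≡ true → W y ≡ true → adj G x y ≡ true →
    ∃ λ z → W z ≡ true × adj G x z ≡ true × adj G y z ≡ true

  triangle⇒3≤degree : ∀ W {v a b} → W v ≡ true → W a ≡ true → W b ≡ true →
    adj G v a ≡ true → adj G v b ≡ true → adj G a b ≡ true → 3 ≤ degree W v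
  triangle⇒3≤degree W {v} {a} {b} Wv Wa Wb adj-va adj-vb adj-ab = length≤count _ (v ∷ a ∷ b ∷ [])
    ((adj⇒≢ G adj-va ∷ adj⇒≢ G adj-vb ∷ []) ∷ (adj⇒≢ G adj-ab ∷ []) ∷ [] ∷ [])
    (∈N[]-self W v Wv ∷ ∈N[]-adj W v a Wa adj-va ∷ ∈N[]-adj W v b Wb adj-vb ∷ [])

  TriangleClosed-∖N[] : ∀ {W} u → TriangleClosed W →
    (∀ y z → (W ∩ N[ u ]) z ≡ true → W y ≡ true → adj G z y ≡ true → (W ∩ N[ u ]) y ≡ true) →
    TriangleClosed (W ∖ N[ u ])
  TriangleClosed-∖N[] {W} u tc closed y₁ y₂ R₁ R₂ adj₁₂
    with tc y₁ y₂ (∧-conicalˡ _ _ R₁) (∧-conicalˡ _ _ R₂) adj₁₂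
  ... | z , Wz , adj₁z , adj₂z = z , Rz , adj₁z , adj₂z
    where
    Rz : (W ∖ N[ u ]) z ≡ true
    Rz with N[ u ] z in uz
    ... | false = cong (_∧ true) Wz
    ... | true with () ← trans (sym (∖-∉ W N[ u ] y₁ R₁))
                          (∧-conicalʳ (W y₁) _ (closed y₁ z (∧-≡-true Wz uz) (∧-conicalˡ _ _ R₁)
                            (trans (adj-sym G z y₁) adj₁z)))

  module MinDegreeThree {q : ℕ} {W : VertexSet n} (tc : TriangleClosed W) (|W|≤ : count W ≤ 5 + 3 * q)
    (IH : ∀ W′ → TriangleClosed W′ → count W′ ≤ 2 + 3 * q → MISBound W′ (16 * 3 ^ q))
    {v a b : Fin n} (Wv : W v ≡ true) (Wa : W a ≡ true) (Wb : W b ≡ true)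
    (adj-va : adj G v a ≡ true) (adj-vb : adj G v b ≡ true) (adj-ab : adj G a b ≡ true)
    (minimal : ∀ u → W u ≡ true → degree W v ≤ degree W u) (deg-v : degree W v ≡ 3) where

    T : List (Fin n)
    T = v ∷ a ∷ b ∷ []

    T-unique : Unique T
    T-unique = (adj⇒≢ G adj-va ∷ adj⇒≢ G adj-vb ∷ []) ∷ (adj⇒≢ G adj-ab ∷ []) ∷ [] ∷ []

    T⊆W : ∀ {t} → t ∈ T → W t ≡ true
    T⊆W (here refl) = Wv
    T⊆W (there (here refl)) = Wa
    T⊆W (there (there (here refl))) = Wb

    T-clique : ∀ {s t} → s ∈ T → t ∈ T → (W ∩ N[ t ]) s ≡ true
    T-clique (here refl)                 (here refl)                 = ∈N[]-self W v Wv
    T-clique (there (here refl))         (here refl)                 = ∈N[]-adj W v a Wa adj-va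
    T-clique (there (there (here refl))) (here refl)                 = ∈N[]-adj W v b Wb adj-vb
    T-clique (here refl)                 (there (here refl))         = ∈N[]-adj W a v Wv (trans (adj-sym G a v) adj-va)
    T-clique (there (here refl))         (there (here refl))         = ∈N[]-self W a Wa
    T-clique (there (there (here refl))) (there (here refl))         = ∈N[]-adj W a b Wb adj-ab
    T-clique (here refl)                 (there (there (here refl))) = ∈N[]-adj W b v Wv (trans (adj-sym G b v) adj-vb)
    T-clique (there (here refl))         (there (there (here refl))) = ∈N[]-adj W b a Wa (trans (adj-sym G b a) adj-ab)
    T-clique (there (there (here refl))) (there (there (here refl))) = ∈N[]-self W b Wb

    N[]⊆T : ∀ {t} → t ∈ T → degree W t ≡ 3 → ∀ y → (W ∩ N[ t ]) y ≡ true → y ∈ T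
    N[]⊆T t∈T deg-t = count≤length⇒∈ (W ∩ N[ _ ]) T T-unique
      (All.tabulate λ s∈T → T-clique s∈T t∈T) (≤-reflexive deg-t)

    T-covers : ∀ (bv ba bb : ℕ) S → IsMIS W S →
      Any (λ k → lookup S (proj₁ k) ≡ true) ((v , bv) ∷ (a , ba) ∷ (b , bb) ∷ [])
    T-covers _ _ _ S (mis ⊆W _ dom) with lookup S v in Sv
    ... | true = here Sv
    ... | false with dom v Wv Sv
    ... | y , Sy , adj-vy with N[]⊆T (here refl) deg-v y (∈N[]-adj W v y (⊆W y Sy) adj-vy)
    ... | here refl                 = here Sy
    ... | there (here refl)         = there (here Sy)
    ... | there (there (here refl)) = there (there (here Sy))

    3≤degree : ∀ u → W u ≡ true → 3 ≤ degree W u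
    3≤degree u Wu = subst (_≤ degree W u) deg-v (minimal u Wu)

    branch-18 : ∀ u → W u ≡ true → MISBound (W ∖ N[ u ]) (18 * 3 ^ q)
    branch-18 u Wu = subst (MISBound _) (moonMoser[+3*] 2 q) (MISBound-∖N[] W u |W|≤ (3≤degree u Wu))

    branch-12 : ∀ u → W u ≡ true → degree W u ≢ 3 → MISBound (W ∖ N[ u ]) (12 * 3 ^ q)
    branch-12 u Wu deg≢3 = subst (MISBound _) (moonMoser[+3*] 1 q)
      (MISBound-∖N[] W u |W|≤ (≤∧≢⇒< (3≤degree u Wu) (deg≢3 ∘ sym)))

    -- When all of T has degree 3, T is a component of G[W], so deleting it keeps W triangle-closed.
    branch-16 : degree W a ≡ 3 → degree W b ≡ 3 → ∀ {u} → u ∈ T → MISBound (W ∖ N[ u ]) (16 * 3 ^ q)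
    branch-16 deg-a deg-b {u} u∈T = IH _ (TriangleClosed-∖N[] u tc closed)
      (count-∖N[]≤ W u |W|≤ (3≤degree u (T⊆W u∈T)))
      where
      deg≡3 : ∀ {t} → t ∈ T → degree W t ≡ 3
      deg≡3 (here refl) = deg-v
      deg≡3 (there (here refl)) = deg-a
      deg≡3 (there (there (here refl))) = deg-b
      closed : ∀ y z → (W ∩ N[ u ]) z ≡ true → W y ≡ true → adj G z y ≡ true →
               (W ∩ N[ u ]) y ≡ true
      closed y z z∈N[u] Wy adj-zy = T-clique y∈T u∈T
        where
        z∈T : z ∈ T
        z∈T = N[]⊆T u∈T (deg≡3 u∈T) z z∈N[u]
        y∈T : y ∈ T
        y∈T = N[]⊆T z∈T (deg≡3 z∈T) y (∈N[]-adj W z y Wy adj-zy)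

    16+16+16 : ∀ x → 16 * x + (16 * x + (16 * x + 0)) ≡ 16 * (3 * x)
    16+16+16 = solve-∀

    18+18+12 : ∀ x → 18 * x + (18 * x + (12 * x + 0)) ≡ 16 * (3 * x)
    18+18+12 = solve-∀

    18+12+18 : ∀ x → 18 * x + (12 * x + (18 * x + 0)) ≡ 16 * (3 * x)
    18+12+18 = solve-∀

    48≡16*3 : ∀ x → 48 * x ≡ 16 * (3 * x)
    48≡16*3 = solve-∀

    18+12+12 : ∀ x → 18 * x + (12 * x + (12 * x + 0)) ≡ 42 * x
    18+12+12 = solve-∀

    MISBound-minDegreeThree : MISBound W (16 * 3 ^ suc q)
    MISBound-minDegreeThree with degree W a ≟ℕ 3 | degree W b ≟ℕ 3
    ... | yes deg-a | yes deg-b = MISBound-weaken (≤-reflexive (16+16+16 (3 ^ q)))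
      (MISBound-cover W _ (T-covers _ _ _) (branch-16 deg-a deg-b (here refl)
        ∷ branch-16 deg-a deg-b (there (here refl)) ∷ branch-16 deg-a deg-b (there (there (here refl))) ∷ []))
    ... | yes _ | no deg-b = MISBound-weaken (≤-reflexive (18+18+12 (3 ^ q)))
      (MISBound-cover W _ (T-covers _ _ _) (branch-18 v Wv ∷ branch-18 a Wa ∷ branch-12 b Wb deg-b ∷ []))
    ... | no deg-a | yes _ = MISBound-weaken (≤-reflexive (18+12+18 (3 ^ q)))
      (MISBound-cover W _ (T-covers _ _ _) (branch-18 v Wv ∷ branch-12 a Wa deg-a ∷ branch-18 b Wb ∷ []))
    ... | no deg-a | no deg-b = MISBound-weaken (18+12+12≤ (3 ^ q))
      (MISBound-cover W _ (T-covers _ _ _) (branch-18 v Wv ∷ branch-12 a Wa deg-a ∷ branch-12 b Wb deg-b ∷ []))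
      where
      18+12+12≤ : ∀ x → 18 * x + (12 * x + (12 * x + 0)) ≤ 16 * (3 * x)
      18+12+12≤ x = ≤-trans (≤-reflexive (18+12+12 x))
                    (≤-trans (*-monoˡ-≤ x (m≤m+n 42 6)) (≤-reflexive (48≡16*3 x)))

  TriangleClosedBound : ℕ → Set
  TriangleClosedBound q = ∀ W → TriangleClosed W → count W ≤ 2 + 3 * q → MISBound W (16 * 3 ^ q)

  TriangleClosedBound-step : ∀ q → (∀ {p} → q ≡ suc p → TriangleClosedBound p) → TriangleClosedBound q
  TriangleClosedBound-step q IH W tc |W|≤ with argmin W (degree W)
  ... | inj₁ empty = MISBound-weaken (≤-trans (9≤moonMoser (1 + 3 * q)) (moonMoser[1+3*]≤16*3^ q))
                       (MISBound-empty empty)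
  ... | inj₂ (v , Wv , minimal) = by-degree (degree W v) refl
    where
    m : ℕ
    m = 2 + 3 * q
    minDegree-bound : ∀ k → degree W v ≡ k → MISBound W (k * moonMoser (m ∸ k))
    minDegree-bound k deg-v = subst (λ k → MISBound W (k * moonMoser (m ∸ k))) deg-v
      (MISBound-minDegree W v m Wv minimal |W|≤)
    k≤m : ∀ {k} → degree W v ≡ k → k ≤ m
    k≤m deg-v = subst (_≤ m) deg-v (≤-trans (degree≤count W v) |W|≤)
    by-degree : ∀ k → degree W v ≡ k → MISBound W (16 * 3 ^ q)
    by-degree 0 deg-v = contradiction (subst (1 ≤_) deg-v (1≤degree W v Wv)) λ ()
    by-degree 1 deg-v = MISBound-weaken (≤-trans (≤-reflexive (*-identityˡ _)) (moonMoser[1+3*]≤16*3^ q))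
      (minDegree-bound 1 deg-v)
    by-degree 2 deg-v with neighbour W v (≤-reflexive (sym deg-v))
    ... | a , Wa , adj-va with tc v a Wv Wa adj-va
    ... | b , Wb , adj-vb , adj-ab = contradiction
          (subst (3 ≤_) deg-v (triangle⇒3≤degree W Wv Wa Wb adj-va adj-vb adj-ab)) λ { (s≤s (s≤s ())) }
    by-degree 3 deg-v = degree-three q refl
      where
      degree-three : ∀ q′ → q ≡ q′ → MISBound W (16 * 3 ^ q)
      degree-three zero refl = contradiction (k≤m deg-v) λ { (s≤s (s≤s ())) }
      degree-three (suc p) refl with neighbour W v (≤-trans (n≤1+n 2) (≤-reflexive (sym deg-v)))
      ... | a , Wa , adj-va with tc v a Wv Wa adj-va
      ... | b , Wb , adj-vb , adj-ab = MinDegreeThree.MISBound-minDegreeThree {q = p} tc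
            (≤-trans |W|≤ (≤-reflexive (2+3[1+p]≡5+3p p))) (IH refl)
            Wv Wa Wb adj-va adj-vb adj-ab minimal deg-v
        where
        2+3[1+p]≡5+3p : ∀ p → 2 + 3 * suc p ≡ 5 + 3 * p
        2+3[1+p]≡5+3p = solve-∀
    by-degree (suc (suc (suc (suc j)))) deg-v = MISBound-weaken
      ([4+]*moonMoser≤16*3^ j (m ∸ (4 + j)) q (m+[n∸m]≡n (k≤m deg-v))) (minDegree-bound (4 + j) deg-v)

  MISBound-triangleClosed : ∀ q → TriangleClosedBound q
  MISBound-triangleClosed zero = TriangleClosedBound-step zero λ ()
  MISBound-triangleClosed (suc p) = TriangleClosedBound-step (suc p) λ { refl → MISBound-triangleClosed p }

MISBound-nineG : ∀ {n} (G : Graph n) → TriangleClosed G allVertices → MISBound G allVertices (nineG n)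
MISBound-nineG {n} G tc = by-residue (n % 3) (n / 3) (m%n<n n 3)
  (trans (m≡m%n+[m/n]*n n 3) (cong (n % 3 +_) (*-comm (n / 3) 3)))
  where
  |V|≤ : ∀ {m} → n ≡ m → count (allVertices {n}) ≤ m
  |V|≤ n≡m = ≤-reflexive (trans (count-allVertices n) n≡m)
  by-residue : ∀ r q → r < 3 → n ≡ r + 3 * q → MISBound G allVertices (nineG-aux q r)
  by-residue 0 q _ n≡ = subst (MISBound G allVertices) (moonMoser[+3*] 0 q) (MISBound-moonMoser G _ _ (|V|≤ n≡))
  by-residue 1 q _ n≡ = subst (MISBound G allVertices) (trans (moonMoser[+3*] 1 q) (12*3^q≡4*3^[q+1] q))
    (MISBound-moonMoser G _ _ (|V|≤ n≡))
    where
    12*3^q≡4*3^[q+1] : ∀ q → 12 * 3 ^ q ≡ 4 * 3 ^ (q + 1)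
    12*3^q≡4*3^[q+1] q rewrite +-comm q 1 = *-assoc 4 3 (3 ^ q)
  by-residue 2 q _ n≡ = MISBound-triangleClosed G q allVertices tc (|V|≤ n≡)
  by-residue (suc (suc (suc _))) _ (s≤s (s≤s (s≤s ())))

-- The shadow graph of a 3-uniform hypergraph

module _ {n : ℕ} (H : Hypergraph3 n) where

  shareEdge : Fin n → Fin n → Bool
  shareEdge x y = any (λ e → lookup e x ∧ lookup e y) (edges H)

  shadow : Graph n
  shadow = record
    { adj     = λ x y → not (x == y) ∧ shareEdge x y
    ; adj-sym = λ x y → cong₂ (λ b c → not b ∧ c) (==-sym x y)
                  (cong (foldr _∨_ false) (map-cong (λ e → ∧-comm (lookup e x) (lookup e y)) (edges H)))
    ; adj-irr = λ x → cong (λ b → not b ∧ shareEdge x x) (==-refl x)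
    }

  shadow-adj⇒edge : ∀ {x y} → adj shadow x y ≡ true →
    ∃ λ e → e ∈ edges H × lookup e x ≡ true × lookup e y ≡ true
  shadow-adj⇒edge {x} {y} adj-xy with find (any⁻ _ (edges H) (Equivalence.from T-≡ (∧-conicalʳ _ _ adj-xy)))
  ... | e , e∈H , x,y∈e = e , e∈H , ∧-conicalˡ _ _ x,y∈e′ , ∧-conicalʳ (lookup e x) _ x,y∈e′
    where
    x,y∈e′ : lookup e x ∧ lookup e y ≡ true
    x,y∈e′ = Equivalence.to T-≡ x,y∈e

  edge⇒shadow-adj : ∀ {e x y} → e ∈ edges H → lookup e x ≡ true → lookup e y ≡ true → x ≢ y →
    adj shadow x y ≡ true
  edge⇒shadow-adj e∈H ex ey x≢y rewrite ==-≢ x≢y =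
    Equivalence.to T-≡ (any⁺ _ (lose e∈H (Equivalence.from T-≡ (∧-≡-true ex ey))))

  SI⇒Independent : ∀ {S} → StronglyIndependent H S → Independent shadow S
  SI⇒Independent {S} si x y Sx Sy with adj shadow x y in adj-xy
  ... | false = refl
  ... | true with shadow-adj⇒edge adj-xy
  ... | e , e∈H , ex , ey = contradiction (si e e∈H) (<⇒≱ (subst (2 ≤_) (sym (∣∩ₛ∣≡count e S))
        (length≤count _ (x ∷ y ∷ []) ((adj⇒≢ shadow adj-xy ∷ []) ∷ [] ∷ [])
          (∧-≡-true ex Sx ∷ ∧-≡-true ey Sy ∷ []))))

  Independent⇒SI : ∀ {S} → Independent shadow S → StronglyIndependent H S
  Independent⇒SI {S} indep e e∈H = subst (_≤ 1) (sym (∣∩ₛ∣≡count e S)) (count≤1 _ at-most-one)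
    where
    at-most-one : ∀ x y → lookup e x ∧ lookup S x ≡ true → lookup e y ∧ lookup S y ≡ true → x ≡ y
    at-most-one x y x∈e∩S y∈e∩S with x ≟ y
    ... | yes x≡y = x≡y
    ... | no  x≢y = contradiction
      (trans (sym (indep x y (∧-conicalʳ (lookup e x) _ x∈e∩S) (∧-conicalʳ (lookup e y) _ y∈e∩S)))
             (edge⇒shadow-adj e∈H (∧-conicalˡ _ _ x∈e∩S) (∧-conicalˡ _ _ y∈e∩S) x≢y))
      λ ()

  MaximalSI⇒IsMIS : ∀ {S} → MaximalSI H S → IsMIS shadow allVertices S
  MaximalSI⇒IsMIS {S} (si , maximal) = mis (λ _ _ → refl) (SI⇒Independent si) dominating
    where
    dominating : ∀ x → allVertices x ≡ true → lookup S x ≡ false →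
                 ∃ λ y → lookup S y ≡ true × adj shadow x y ≡ true
    dominating x _ Sx with any? (λ y → lookup S y ∧ adj shadow x y ≟ᵇ true)
    ... | yes (y , Sy∧adj) = y , ∧-conicalˡ _ _ Sy∧adj , ∧-conicalʳ (lookup S y) _ Sy∧adj
    ... | no  ∄y = ⊥-elim $ maximal (S ∪ ⁅ x ⁆)
                     (p⊆p∪q ⁅ x ⁆ , x , q⊆p∪q S ⁅ x ⁆ (x∈⁅x⁆ x) , x∉S) (Independent⇒SI independent)
      where
      x∉S : ¬ x ∈ₛ S
      x∉S x∈S = contradiction (trans (sym Sx) ([]=⇒lookup x∈S)) λ ()
      ¬adj : ∀ y → lookup S y ≡ true → adj shadow y x ≡ false
      ¬adj y Sy = trans (adj-sym shadow y x) (¬-not λ adj-xy → ∄y (y , ∧-≡-true Sy adj-xy))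
      independent : Independent shadow (S ∪ ⁅ x ⁆)
      independent y z y∈ z∈
        with x∈p∪q⁻ S ⁅ x ⁆ (lookup⇒[]= y _ y∈) | x∈p∪q⁻ S ⁅ x ⁆ (lookup⇒[]= z _ z∈)
      ... | inj₁ y∈S | inj₁ z∈S = SI⇒Independent si y z ([]=⇒lookup y∈S) ([]=⇒lookup z∈S)
      ... | inj₁ y∈S | inj₂ z∈x rewrite x∈⁅y⁆⇒x≡y x z∈x = ¬adj y ([]=⇒lookup y∈S)
      ... | inj₂ y∈x | inj₁ z∈S rewrite x∈⁅y⁆⇒x≡y x y∈x =
        trans (adj-sym shadow x z) (¬adj z ([]=⇒lookup z∈S))
      ... | inj₂ y∈x | inj₂ z∈x rewrite x∈⁅y⁆⇒x≡y x y∈x | x∈⁅y⁆⇒x≡y x z∈x = adj-irr shadow x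

  IsMIS⇒MaximalSI : ∀ {S} → IsMIS shadow allVertices S → MaximalSI H S
  IsMIS⇒MaximalSI {S} (mis _ indep dom) = Independent⇒SI indep , not-extendable
    where
    not-extendable : ∀ T → S ⊂ T → ¬ StronglyIndependent H T
    not-extendable T (S⊆T , x , x∈T , x∉S) siT with dom x refl (¬-not (x∉S ∘ lookup⇒[]= x S))
    ... | y , Sy , adj-xy = contradiction
      (trans (sym (SI⇒Independent siT x y ([]=⇒lookup x∈T) ([]=⇒lookup (S⊆T (lookup⇒[]= y S Sy)))))
             adj-xy)
      λ ()

  shadow-triangleClosed : TriangleClosed shadow allVertices
  shadow-triangleClosed x y _ _ adj-xy with shadow-adj⇒edge adj-xy
  ... | e , e∈H , ex , ey with count>length⇒∃∉ (lookup e) (x ∷ y ∷ []) 2<|e|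
    where
    2<|e| : 2 < count (lookup e)
    2<|e| = subst (2 <_) (trans (sym (All.lookup (uniform H) e∈H)) (∣∣≡count e)) ≤-refl
  ... | z , ez , z∉xy = z , refl , edge⇒shadow-adj e∈H ex ez (z∉xy ∘ here ∘ sym)
                                 , edge⇒shadow-adj e∈H ey ez (z∉xy ∘ there ∘ here ∘ sym)

MaximalSI-upperBound : ∀ n (H : Hypergraph3 n) (L : List (Subset n)) → Unique L → All (MaximalSI H) L →
  length L * 9 ≤ nineG n
MaximalSI-upperBound n H L uL mL =
  MISBound-nineG (shadow H) (shadow-triangleClosed H) L uL (All.map (MaximalSI⇒IsMIS H) mL)

-- Extremal hypergraphs

_⊕_ : ∀ {m n} → Hypergraph3 m → Hypergraph3 n → Hypergraph3 (m + n)
_⊕_ {m} {n} H₁ H₂ = record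
  { edges   = map (Vec._++ ∅) (edges H₁) ++ map (∅ Vec.++_) (edges H₂)
  ; uniform = ++⁺ (map⁺ (All.map (λ {e} → trans (∣++∅∣ e)) (uniform H₁)))
                  (map⁺ (All.map (λ {e} → trans (∣∅++∣ m e)) (uniform H₂)))
  }

module _ {m n : ℕ} (H₁ : Hypergraph3 m) (H₂ : Hypergraph3 n) where

  private
    ∅ₘ : Subset m
    ∅ₘ = ∅
    ∅ₙ : Subset n
    ∅ₙ = ∅
    lookup-∅++-↑ˡ : ∀ (e : Subset n) x → lookup (∅ₘ Vec.++ e) (x ↑ˡ n) ≡ false
    lookup-∅++-↑ˡ e x = trans (lookup-++ˡ ∅ₘ e x) (lookup-replicate x false)
    lookup-++∅-↑ʳ : ∀ (e : Subset m) y → lookup (e Vec.++ ∅ₙ) (m ↑ʳ y) ≡ false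
    lookup-++∅-↑ʳ e y = trans (lookup-++ʳ e ∅ₙ y) (lookup-replicate y false)
    shareEdge-⊕ : ∀ x y → shareEdge (H₁ ⊕ H₂) x y ≡
      any (λ e → lookup (e Vec.++ ∅ₙ) x ∧ lookup (e Vec.++ ∅ₙ) y) (edges H₁) ∨
      any (λ e → lookup (∅ₘ Vec.++ e) x ∧ lookup (∅ₘ Vec.++ e) y) (edges H₂)
    shareEdge-⊕ x y = trans (any-++ _ (map (Vec._++ ∅ₙ) (edges H₁)) _)
      (cong₂ _∨_ (any-map (Vec._++ ∅ₙ) (edges H₁)) (any-map (∅ Vec.++_) (edges H₂)))

  adj-⊕-ˡˡ : ∀ x y → adj (shadow (H₁ ⊕ H₂)) (x ↑ˡ n) (y ↑ˡ n) ≡ adj (shadow H₁) x y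
  adj-⊕-ˡˡ x y = cong₂ (λ b c → not b ∧ c) (==-injective (_↑ˡ n) (↑ˡ-injective n _ _) x y)
    (trans (shareEdge-⊕ (x ↑ˡ n) (y ↑ˡ n)) (trans (cong₂ _∨_
      (any-cong (λ e → cong₂ _∧_ (lookup-++ˡ e ∅ₙ x) (lookup-++ˡ e ∅ₙ y)) (edges H₁))
      (any-false-cong (λ e → cong (_∧ lookup (∅ₘ Vec.++ e) _) (lookup-∅++-↑ˡ e x)) (edges H₂)))
      (∨-identityʳ _)))

  adj-⊕-ʳʳ : ∀ x y → adj (shadow (H₁ ⊕ H₂)) (m ↑ʳ x) (m ↑ʳ y) ≡ adj (shadow H₂) x y
  adj-⊕-ʳʳ x y = cong₂ (λ b c → not b ∧ c) (==-injective (m ↑ʳ_) (↑ʳ-injective m _ _) x y)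
    (trans (shareEdge-⊕ (m ↑ʳ x) (m ↑ʳ y)) (cong₂ _∨_
      (any-false-cong (λ e → cong (_∧ lookup (e Vec.++ ∅ₙ) (m ↑ʳ y)) (lookup-++∅-↑ʳ e x))
        (edges H₁))
      (any-cong (λ e → cong₂ _∧_ (lookup-++ʳ ∅ₘ e x) (lookup-++ʳ ∅ₘ e y)) (edges H₂))))

  adj-⊕-ˡʳ : ∀ x y → adj (shadow (H₁ ⊕ H₂)) (x ↑ˡ n) (m ↑ʳ y) ≡ false
  adj-⊕-ˡʳ x y = trans (cong (not ((x ↑ˡ n) == (m ↑ʳ y)) ∧_)
    (trans (shareEdge-⊕ (x ↑ˡ n) (m ↑ʳ y)) (cong₂ _∨_
      (any-false-cong (λ e → trans (cong (lookup (e Vec.++ ∅ₙ) (x ↑ˡ n) ∧_) (lookup-++∅-↑ʳ e y)) (∧-zeroʳ _))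
        (edges H₁))
      (any-false-cong (λ e → cong (_∧ lookup (∅ₘ Vec.++ e) _) (lookup-∅++-↑ˡ e x)) (edges H₂)))))
    (∧-zeroʳ _)

  IsMIS-++ : ∀ {S₁ S₂} → IsMIS (shadow H₁) allVertices S₁ → IsMIS (shadow H₂) allVertices S₂ →
    IsMIS (shadow (H₁ ⊕ H₂)) allVertices (S₁ Vec.++ S₂)
  IsMIS-++ {S₁} {S₂} (mis _ indep₁ dom₁) (mis _ indep₂ dom₂) = mis (λ _ _ → refl) indep dom
    where
    G : Graph (m + n)
    G = shadow (H₁ ⊕ H₂)
    indep : Independent G (S₁ Vec.++ S₂)
    indep z w z∈ w∈ with splitView m n z | splitView m n w
    ... | left x  | left y  = trans (adj-⊕-ˡˡ x y)
          (indep₁ x y (trans (sym (lookup-++ˡ S₁ S₂ x)) z∈) (trans (sym (lookup-++ˡ S₁ S₂ y)) w∈))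
    ... | right x | right y = trans (adj-⊕-ʳʳ x y)
          (indep₂ x y (trans (sym (lookup-++ʳ S₁ S₂ x)) z∈) (trans (sym (lookup-++ʳ S₁ S₂ y)) w∈))
    ... | left x  | right y = adj-⊕-ˡʳ x y
    ... | right x | left y  = trans (adj-sym G (m ↑ʳ x) (y ↑ˡ n)) (adj-⊕-ˡʳ y x)
    dom : ∀ z → allVertices z ≡ true → lookup (S₁ Vec.++ S₂) z ≡ false →
          ∃ λ w → lookup (S₁ Vec.++ S₂) w ≡ true × adj G z w ≡ true
    dom z _ z∉ with splitView m n z
    ... | left x with dom₁ x refl (trans (sym (lookup-++ˡ S₁ S₂ x)) z∉)
    ...   | y , y∈ , adj-xy = y ↑ˡ n , trans (lookup-++ˡ S₁ S₂ y) y∈ , trans (adj-⊕-ˡˡ x y) adj-xy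
    dom z _ z∉ | right x with dom₂ x refl (trans (sym (lookup-++ʳ S₁ S₂ x)) z∉)
    ...   | y , y∈ , adj-xy = m ↑ʳ y , trans (lookup-++ʳ S₁ S₂ y) y∈ , trans (adj-⊕-ʳʳ x y) adj-xy

record Extremal (n : ℕ) : Set where
  field
    hypergraph   : Hypergraph3 n
    MISs         : List (Subset n)
    MISs-unique  : Unique MISs
    MISs-maximal : All (IsMIS (shadow hypergraph) allVertices) MISs
    MISs-count   : length MISs * 9 ≡ nineG n
open Extremal

Extremal-⊕ : ∀ {m n} → Extremal m → Extremal n → nineG m * nineG n ≡ 9 * nineG (m + n) →
  Extremal (m + n)
Extremal-⊕ {m} {n} E₁ E₂ g-multiplicative = record
  { hypergraph   = hypergraph E₁ ⊕ hypergraph E₂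
  ; MISs         = L
  ; MISs-unique  = Unique.cartesianProductWith⁺ Vec._++_ (λ {w} {x} → ++-injective w x)
                     (MISs-unique E₁) (MISs-unique E₂)
  ; MISs-maximal = cartesianProductWith⁺ (setoid _) (setoid _) Vec._++_ L₁ L₂
                     λ S₁∈ S₂∈ → IsMIS-++ (hypergraph E₁) (hypergraph E₂)
                                   (All.lookup (MISs-maximal E₁) S₁∈) (All.lookup (MISs-maximal E₂) S₂∈)
  ; MISs-count   = *-cancelˡ-≡ _ _ 9 (begin
      9 * (length L * 9)            ≡⟨ cong (λ l → 9 * (l * 9)) (length-cartesianProductWith Vec._++_ L₁ L₂) ⟩
      9 * (length L₁ * length L₂ * 9) ≡⟨ regroup (length L₁) (length L₂) ⟩
      (length L₁ * 9) * (length L₂ * 9) ≡⟨ cong₂ _*_ (MISs-count E₁) (MISs-count E₂) ⟩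
      nineG m * nineG n             ≡⟨ g-multiplicative ⟩
      9 * nineG (m + n)             ∎)
  }
  where
  open ≡-Reasoning
  L₁ : List (Subset m)
  L₁ = MISs E₁
  L₂ : List (Subset n)
  L₂ = MISs E₂
  L : List (Subset (m + n))
  L = cartesianProductWith Vec._++_ L₁ L₂
  regroup : ∀ a b → 9 * (a * b * 9) ≡ (a * 9) * (b * 9)
  regroup = solve-∀

IsMIS? : ∀ {n} (G : Graph n) (W : VertexSet n) (S : Subset n) → Dec (IsMIS G W S)
IsMIS? G W S = map′ (λ (⊆W , indep , dom) → mis ⊆W indep dom) (λ (mis ⊆W indep dom) → ⊆W , indep , dom)
  ( all? (λ x → (lookup S x ≟ᵇ true) →-dec (W x ≟ᵇ true))
  ×-dec all? (λ x → all? λ y →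
                (lookup S x ≟ᵇ true) →-dec ((lookup S y ≟ᵇ true) →-dec (adj G x y ≟ᵇ false)))
  ×-dec all? (λ x → (W x ≟ᵇ true) →-dec ((lookup S x ≟ᵇ false) →-dec
                     any? λ y → (lookup S y ≟ᵇ true) ×-dec (adj G x y ≟ᵇ true))))

Extremal-by-computation : ∀ {n} (H : Hypergraph3 n) (L : List (Subset n)) →
  True (unique? (≡-dec _≟ᵇ_) L) → True (All.all? (IsMIS? (shadow H) allVertices) L) →
  length L * 9 ≡ nineG n → Extremal n
Extremal-by-computation H L unique maximal count = record
  { hypergraph = H ; MISs = L ; MISs-unique = toWitness unique
  ; MISs-maximal = toWitness maximal ; MISs-count = count }

triangle : Hypergraph3 3
triangle = record { edges = ⊤ ∷ [] ; uniform = refl ∷ [] }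

K⁽³⁾₄ : Hypergraph3 4
K⁽³⁾₄ = record { edges = map (∁ ∘ ⁅_⁆) (allFin 4) ; uniform = refl ∷ refl ∷ refl ∷ refl ∷ [] }

extremal-3 : Extremal 3
extremal-3 = Extremal-by-computation triangle (map ⁅_⁆ (allFin 3)) _ _ refl

extremal-4 : Extremal 4
extremal-4 = Extremal-by-computation K⁽³⁾₄ (map ⁅_⁆ (allFin 4)) _ _ refl

nineG-+3 : ∀ n → nineG (3 + n) ≡ 3 * nineG n
nineG-+3 n = trans (cong₂ nineG-aux (m/n≡1+[m∸n]/n {3 + n} {3} (s≤s (s≤s (s≤s z≤n))))
                                     (trans (cong (_% 3) (+-comm 3 n)) ([m+n]%n≡m%n n 3)))
                   (nineG-aux-suc (n / 3) (n % 3))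
  where
  nineG-aux-suc : ∀ q r → nineG-aux (suc q) r ≡ 3 * nineG-aux q r
  nineG-aux-suc q 0 = x∙yz≈y∙xz 9 3 (3 ^ q)
  nineG-aux-suc q 1 = x∙yz≈y∙xz 4 3 (3 ^ (q + 1))
  nineG-aux-suc q (suc (suc r)) = x∙yz≈y∙xz 16 3 (3 ^ q)

extremal : ∀ k → Extremal (6 + k)
extremal 0 = Extremal-⊕ extremal-3 extremal-3 refl
extremal 1 = Extremal-⊕ extremal-3 extremal-4 refl
extremal 2 = Extremal-⊕ extremal-4 extremal-4 refl
extremal (suc (suc (suc k))) = Extremal-⊕ extremal-3 (extremal k)
  (trans (*-assoc 9 3 (nineG (6 + k))) (cong (9 *_) (sym (nineG-+3 (6 + k)))))

AttainsBound : ℕ → Set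
AttainsBound n = Σ (Hypergraph3 n) λ H → ∃ λ (L : List (Subset n))
  → Unique L × All (MaximalSI H) L × (∀ S → MaximalSI H S → S ∈ L) × length L * 9 ≡ nineG n

Extremal⇒AttainsBound : ∀ {n} → Extremal n → AttainsBound n
Extremal⇒AttainsBound {n} E = H , L , MISs-unique E , maximal , complete , MISs-count E
  where
  H : Hypergraph3 n
  H = hypergraph E
  L : List (Subset n)
  L = MISs E
  maximal : All (MaximalSI H) L
  maximal = All.map (IsMIS⇒MaximalSI H) (MISs-maximal E)
  -- A maximal set missing from L would push the count past the upper bound.
  complete : ∀ S → MaximalSI H S → S ∈ L
  complete S S-max with Any.any? (≡-dec _≟ᵇ_ S) L
  ... | yes S∈L = S∈L
  ... | no  S∉L = contradiction
    (MaximalSI-upperBound n H (S ∷ L) (¬Any⇒All¬ L S∉L ∷ MISs-unique E) (S-max ∷ maximal))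
    (<⇒≱ (subst (_< 9 + length L * 9) (MISs-count E) (m<n+m (length L * 9) {9} (s≤s z≤n))))

theorem2 : ((n : ℕ) (H : Hypergraph3 n) (L : List (Subset n))
    → Unique L → All (MaximalSI H) L → length L * 9 ≤ nineG n)
    × ((n : ℕ) → 6 ≤ n → Σ (Hypergraph3 n) λ H → ∃ λ (L : List (Subset n))
    → Unique L × All (MaximalSI H) L × (∀ S → MaximalSI H S → S ∈ L)
    × length L * 9 ≡ nineG n)
theorem2 = MaximalSI-upperBound
         , λ n 6≤n → subst AttainsBound (m+[n∸m]≡n 6≤n) (Extremal⇒AttainsBound (extremal (n ∸ 6)))
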